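{- For every $n\ge 3$, the cycle graph $C_n$ has a canonical ESD labeling.
   Context: For a graph $G=(V,E)$ and $l\in\mathbb N$, a vertex labeling $\phi:V\to\{1,\dots,l\}$ is an edge-sum distinguishing (ESD) labeling if $\phi$ is injective and the edge-weights $w_\phi(uv)=\phi(u)+\phi(v)$ are pairwise distinct over all edges $uv\in E$. It is a canonical ESD labeling if $l=|V|$. -}

module Defs where

open import Data.Nat using (ℕ; suc; _+_; _≤_)
open import Data.Nat.Properties using ()
open import Data.Fin using (Fin; toℕ; fromℕ<)
open import Data.Fin.Properties using ()
open import Data.List using (List; map; allFin)
open import Data.List.Relation.Unary.Unique.Propositional using (Unique)
open import Data.Product using (_×_; _,_; proj₁; proj₂)
open import Data.Nat.DivMod using (_mod_)
open import Function.Definitions using (Injective)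
open import Relation.Binary.PropositionalEquality using (_≡_)

-- A (finite simple) graph on the vertex set Fin n, given by its list of
-- edges; each edge {u,v} is listed exactly once as an ordered pair (u , v).
record Graph : Set where
  field
    order : ℕ
    edges : List (Fin order × Fin order)
open Graph public

-- The cycle C_n on vertices 0,…,n-1 with edges {i, i+1 mod n}, i = 0,…,n-1.
-- (For n ≥ 3 these n edges are pairwise distinct unordered pairs.)
cycleEdges : (n : ℕ) → List (Fin (suc n) × Fin (suc n))
cycleEdges n = map (λ i → i , (suc (toℕ i)) mod (suc n)) (allFin (suc n))

Cycle : (m : ℕ) → Graph
Cycle m = record { order = suc m ; edges = cycleEdges m }

edgeWeight : {n : ℕ} → (Fin n → ℕ) → Fin n × Fin n → ℕ
edgeWeight φ (u , v) = φ u + φ v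

record IsESDLabeling (G : Graph) (l : ℕ) (φ : Fin (order G) → ℕ) : Set where
  field
    range     : ∀ v → 1 ≤ φ v × φ v ≤ l
    injective : Injective _≡_ _≡_ φ
    distinctWeights : Unique (map (edgeWeight φ) (edges G))

IsCanonicalESDLabeling : (G : Graph) → (Fin (order G) → ℕ) → Set
IsCanonicalESDLabeling G φ = IsESDLabeling G (order G) φ

module Submission where

-- We write n = m + 1 and label vertex i of C_n by f i for a sequence
-- f : ℕ → ℕ.  The edges of C_n are the m path edges {k, k+1} (k < m) and
-- the wrap-around edge {m, 0}.  If f k < f (k+2) for all k, the path weights
-- f k + f (k+1) strictly increase in k, so they are pairwise distinct; it
-- then suffices that f is injective with values in [1, n] on [0, m] and that
-- the wrap weight f m + f 0 is not a path weight (`CycleLabeling`).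
--
-- Two sequences cover all n ≥ 3, distinguished by the parity of m:
--   * n odd  (m = 2j):    1, 2, 3, …, n   path weights 2k+3 are odd, while
--                                          the wrap weight n + 1 is even;
--   * n even (m = 2i+3):  2, 1, 3, …, n   path weights are 3, 4 and then odd,
--                                          the wrap weight n + 2 ≥ 6 is even.

open import Defs
open import Data.Nat using (ℕ; zero; suc; _+_; _*_; _≤_; _<_; z≤n; s≤s)
open import Data.Nat.Properties
  using (≤-refl; n≤1+n; <-cmp; <-trans; <⇒≢; <⇒≱; +-monoʳ-<; +-comm; *-cancelˡ-≡; suc-injective;
         m≤n⇒m<n∨m≡n; even≢odd)
open import Data.Nat.DivMod using (_mod_; m<n⇒m%n≡m; n%n≡0; m%n<n)
open import Data.Nat.Tactic.RingSolver using (solve-∀)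
open import Data.Fin using (Fin; toℕ)
open import Data.Fin.Properties using (toℕ-injective; toℕ-fromℕ<; toℕ≤pred[n])
open import Data.List using (allFin)
open import Data.List.Properties using (map-∘)
open import Data.List.Relation.Unary.Unique.Propositional using (Unique)
open import Data.List.Relation.Unary.Unique.Propositional.Properties using (map⁺; allFin⁺)
open import Data.Product using (Σ; ∃-syntax; _×_; _,_)
open import Data.Sum using (_⊎_; inj₁; inj₂)
open import Data.Empty using (⊥-elim)
open import Relation.Binary using (tri<; tri≈; tri>)
open import Relation.Binary.PropositionalEquality using (_≡_; _≢_; refl; sym; trans; cong; subst)

succMod : (m k : ℕ) → ℕ
succMod m k = toℕ (suc k mod suc m)

succMod-< : ∀ m k → k < m → succMod m k ≡ suc k
succMod-< m k k<m = trans (toℕ-fromℕ< (m%n<n (suc k) (suc m))) (m<n⇒m%n≡m (s≤s k<m))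

succMod-last : ∀ m → succMod m m ≡ 0
succMod-last m = trans (toℕ-fromℕ< (m%n<n (suc m) (suc m))) (n%n≡0 (suc m))

increasing⇒monotone : {s : ℕ → ℕ} → (∀ k → s k < s (suc k)) → ∀ {k k'} → k < k' → s k < s k'
increasing⇒monotone inc {k} {suc k'} (s≤s k≤k') with m≤n⇒m<n∨m≡n k≤k'
... | inj₁ k<k' = <-trans (increasing⇒monotone inc k<k') (inc k')
... | inj₂ refl = inc k

increasing⇒injective : {s : ℕ → ℕ} → (∀ k → s k < s (suc k)) → ∀ {k k'} → s k ≡ s k' → k ≡ k'
increasing⇒injective inc {k} {k'} e with <-cmp k k'
... | tri< k<k' _ _ = ⊥-elim (<⇒≢ (increasing⇒monotone inc k<k') e)
... | tri≈ _ k≡k' _ = k≡k'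
... | tri> _ _ k>k' = ⊥-elim (<⇒≢ (increasing⇒monotone inc k>k') (sym e))

module CycleLabeling (m : ℕ) (f : ℕ → ℕ)
  (range     : ∀ k → k ≤ m → 1 ≤ f k × f k ≤ suc m)
  (injective : ∀ {k k'} → k ≤ m → k' ≤ m → f k ≡ f k' → k ≡ k')
  (skipUp    : ∀ k → f k < f (suc (suc k)))
  (wrapFresh : ∀ k → k < m → f k + f (suc k) ≢ f m + f 0) where

  pathWeight : ℕ → ℕ
  pathWeight k = f k + f (suc k)

  pathWeight-increasing : ∀ k → pathWeight k < pathWeight (suc k)
  pathWeight-increasing k =
    subst (_< pathWeight (suc k)) (+-comm (f (suc k)) (f k)) (+-monoʳ-< (f (suc k)) (skipUp k))

  weight : ℕ → ℕ
  weight k = f k + f (succMod m k)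

  weight-path : ∀ k → k < m → weight k ≡ pathWeight k
  weight-path k k<m = cong (λ x → f k + f x) (succMod-< m k k<m)

  weight-wrap : weight m ≡ f m + f 0
  weight-wrap = cong (λ x → f m + f x) (succMod-last m)

  weight-injective : ∀ {k k'} → k ≤ m → k' ≤ m → weight k ≡ weight k' → k ≡ k'
  weight-injective k≤m k'≤m e with m≤n⇒m<n∨m≡n k≤m | m≤n⇒m<n∨m≡n k'≤m
  ... | inj₁ k<m  | inj₁ k'<m = increasing⇒injective pathWeight-increasing
                                  (trans (sym (weight-path _ k<m)) (trans e (weight-path _ k'<m)))
  ... | inj₁ k<m  | inj₂ refl = ⊥-elim (wrapFresh _ k<m (trans (sym (weight-path _ k<m)) (trans e weight-wrap)))
  ... | inj₂ refl | inj₁ k'<m = ⊥-elim (wrapFresh _ k'<m (trans (sym (weight-path _ k'<m)) (trans (sym e) weight-wrap)))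
  ... | inj₂ refl | inj₂ refl = refl

  labeling : Fin (suc m) → ℕ
  labeling i = f (toℕ i)

  -- The edge list of C_{m+1} is the image of its vertices under the
  -- outgoing-edge map, so its weight list is the injective image of allFin.
  isCanonicalESD : IsCanonicalESDLabeling (Cycle m) labeling
  isCanonicalESD = record
    { range = λ v → range (toℕ v) (toℕ≤pred[n] v)
    ; injective = λ {u} {v} e → toℕ-injective (injective (toℕ≤pred[n] u) (toℕ≤pred[n] v) e)
    ; distinctWeights = subst Unique (map-∘ (allFin (suc m)))
        (map⁺ (λ {u} {v} e → toℕ-injective (weight-injective (toℕ≤pred[n] u) (toℕ≤pred[n] v) e))
              (allFin⁺ (suc m)))
    }

even-or-odd : ∀ n → (∃[ j ] n ≡ 2 * j) ⊎ (∃[ j ] n ≡ suc (2 * j))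
even-or-odd zero = inj₁ (0 , refl)
even-or-odd (suc n) with even-or-odd n
... | inj₁ (j , refl) = inj₂ (j , refl)
... | inj₂ (j , refl) = inj₁ (suc j , double-suc j)
  where
  double-suc : ∀ j → suc (suc (2 * j)) ≡ 2 * suc j
  double-suc = solve-∀

consecutive-odd : ∀ k → suc k + suc (suc k) ≡ suc (2 * suc k)
consecutive-odd = solve-∀

-- For an odd number n = 2j+1 of vertices: the labeling 1, 2, …, n
-- (this needs no lower bound on n).
identityLabeling : ∀ j → Σ (Fin (suc (2 * j)) → ℕ) (IsCanonicalESDLabeling (Cycle (2 * j)))
identityLabeling j = labeling , isCanonicalESD
  where
  -- The wrap weight n + 1 is even, the path weights are odd.
  wrapFresh : ∀ k → k < 2 * j → suc k + suc (suc k) ≢ suc (2 * j) + 1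
  wrapFresh k _ e = even≢odd (suc j) (suc k) (trans (sym (oddWrap j)) (trans (sym e) (consecutive-odd k)))
    where
    oddWrap : ∀ j → suc (2 * j) + 1 ≡ 2 * suc j
    oddWrap = solve-∀

  open CycleLabeling (2 * j) suc (λ k k≤m → s≤s z≤n , s≤s k≤m) (λ _ _ → suc-injective)
    (λ k → n≤1+n (suc (suc k))) wrapFresh

swapFirst : ℕ → ℕ
swapFirst zero                = 2
swapFirst (suc zero)          = 1
swapFirst (suc (suc k))       = suc (suc (suc k))

swapFirst-injective : ∀ {k k'} → swapFirst k ≡ swapFirst k' → k ≡ k'
swapFirst-injective {zero}        {zero}         _ = refl
swapFirst-injective {zero}        {suc zero}     ()
swapFirst-injective {zero}        {suc (suc _)}  ()
swapFirst-injective {suc zero}    {zero}         ()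
swapFirst-injective {suc zero}    {suc zero}     _ = refl
swapFirst-injective {suc zero}    {suc (suc _)}  ()
swapFirst-injective {suc (suc _)} {zero}         ()
swapFirst-injective {suc (suc _)} {suc zero}     ()
swapFirst-injective {suc (suc k)} {suc (suc k')} e = suc-injective e

swappedLabeling : ∀ i → Σ (Fin (suc (suc (2 * suc i))) → ℕ) (IsCanonicalESDLabeling (Cycle (suc (2 * suc i))))
swappedLabeling i = labeling , isCanonicalESD
  where
  m : ℕ
  m = suc (2 * suc i)

  range : ∀ k → k ≤ m → 1 ≤ swapFirst k × swapFirst k ≤ suc m
  range zero          _   = s≤s z≤n , s≤s (s≤s z≤n)
  range (suc zero)    _   = s≤s z≤n , s≤s z≤n
  range (suc (suc k)) k≤m = s≤s z≤n , s≤s k≤m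

  skipUp : ∀ k → swapFirst k < swapFirst (suc (suc k))
  skipUp zero          = ≤-refl
  skipUp (suc zero)    = s≤s (s≤s z≤n)
  skipUp (suc (suc k)) = n≤1+n (suc (suc (suc (suc k))))

  -- The wrap weight n + 2 = 2i+6 is even; it exceeds the even path weight 4,
  -- and the remaining path weights are odd.
  wrapWeight : swapFirst m + swapFirst 0 ≡ 2 * (3 + i)
  wrapWeight = evenWrap i
    where
    evenWrap : ∀ i → suc (suc (2 * suc i)) + 2 ≡ 2 * (3 + i)
    evenWrap = solve-∀

  wrapFresh : ∀ k → k < m → swapFirst k + swapFirst (suc k) ≢ swapFirst m + swapFirst 0
  wrapFresh zero          _ e = even≢odd (3 + i) 1 (trans (sym wrapWeight) (sym e))
  wrapFresh (suc zero)    _ e with *-cancelˡ-≡ 2 (3 + i) 2 (trans e wrapWeight)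
  ... | ()
  wrapFresh (suc (suc k)) _ e =
    even≢odd (3 + i) (3 + k) (trans (sym wrapWeight) (trans (sym e) (consecutive-odd (suc (suc k)))))

  open CycleLabeling m swapFirst range (λ _ _ → swapFirst-injective) skipUp wrapFresh

-- Split on the parity of m = n - 1; the only excluded cycle, n = 2, has m = 1.
theorem6 : (m : ℕ) → 3 ≤ suc m →
    Σ (Fin (order (Cycle m)) → ℕ) (λ φ → IsCanonicalESDLabeling (Cycle m) φ)
theorem6 m 3≤n with even-or-odd m
... | inj₁ (j , refl)      = identityLabeling j
... | inj₂ (zero , refl)   = ⊥-elim (<⇒≱ ≤-refl 3≤n)
... | inj₂ (suc i , refl)  = swappedLabeling i
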